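{- Let $Q$ be an IPC formula and let $\theta = (Z_N, \dots, Z_0)$ be a finite sequence of IPC formulas, each $Z_n$ of the form $QW_n$ or $QQW_n$ for some IPC formula $W_n$, which is closed, i.e. there is an IPC formula $W$ such that both $QW$ and $QQW$ are terms of $\theta$. Then $\mathcal{D}(\theta)$ is a theorem of IPC.
   Context: The Implicational Propositional Calculus (IPC) has formulas built from propositional variables using only $\supset$, the single inference rule modus ponens, and the axiom schemes $X \supset (Y \supset X)$, $[X \supset (Y \supset Z)] \supset [(X \supset Y) \supset (X \supset Z)]$ and $[(X \supset Y) \supset X] \supset X$. For an IPC formula $Z$ write $QZ := Z \supset Q$ (so $QQZ = (Z\supset Q)\supset Q$). For a sequence $\theta = (Z_N, \dots, Z_0)$ of IPC formulas, $\mathcal{D}(\theta) := Z_N \supset (Z_{N-1} \supset ( \cdots (Z_0 \supset Q) \cdots ))$. -}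

module Defs where

open import Data.Nat using (ℕ)
open import Data.List using (List; []; _∷_; foldr)

data Formula : Set where
  var : ℕ → Formula
  _⊃_ : Formula → Formula → Formula

infixr 5 _⊃_

data ⊢_ : Formula → Set where
  ax1 : ∀ {X Y} → ⊢ (X ⊃ (Y ⊃ X))
  ax2 : ∀ {X Y Z} → ⊢ ((X ⊃ (Y ⊃ Z)) ⊃ ((X ⊃ Y) ⊃ (X ⊃ Z)))
  ax3 : ∀ {X Y} → ⊢ (((X ⊃ Y) ⊃ X) ⊃ X)
  mp  : ∀ {X Y} → ⊢ (X ⊃ Y) → ⊢ X → ⊢ Y

infix 3 ⊢_

Q[_]_ : Formula → Formula → Formula
Q[ Q ] Z = Z ⊃ Q

QQ[_]_ : Formula → Formula → Formula
QQ[ Q ] Z = (Z ⊃ Q) ⊃ Q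

-- θ = (Z_N , … , Z_0) as the list Z_N ∷ … ∷ Z_0 ∷ [];
-- 𝒟(θ) = Z_N ⊃ (Z_{N-1} ⊃ ( … (Z_0 ⊃ Q) … ))
𝒟 : Formula → List Formula → Formula
𝒟 Q θ = foldr _⊃_ Q θ

module Submission where

-- If θ contains both QW = W ⊃ Q and QQW = (W ⊃ Q) ⊃ Q, then
-- assuming every term of θ as a hypothesis, modus ponens applied to these two
-- hypotheses yields Q.  Discharging the hypotheses of θ one by one with the
-- deduction theorem turns this into a proof of 𝒟(θ) = Z_N ⊃ ( … (Z_0 ⊃ Q) … ).

open import Defs
open import Data.List using (List; []; _∷_; _++_; foldr)
open import Data.List.Membership.Propositional using (_∈_)
open import Data.List.Membership.Propositional.Properties using (∈-++⁺ˡ)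
open import Data.List.Relation.Unary.All using (All)
open import Data.List.Relation.Unary.Any using (here; there)
open import Data.List.Relation.Binary.Permutation.Propositional using (↭-sym)
open import Data.List.Relation.Binary.Permutation.Propositional.Properties
  using (shift; ∈-resp-↭)
open import Data.Product using (∃; _×_; _,_)
open import Data.Sum using (_⊎_)
open import Relation.Binary.PropositionalEquality using (_≡_; refl)

data _⊩_ (Γ : List Formula) : Formula → Set where
  hyp : ∀ {A} → A ∈ Γ → Γ ⊩ A
  thm : ∀ {A} → ⊢ A → Γ ⊩ A
  app : ∀ {A B} → Γ ⊩ (A ⊃ B) → Γ ⊩ A → Γ ⊩ B

infix 3 _⊩_

closed⇒theorem : ∀ {A} → [] ⊩ A → ⊢ A
closed⇒theorem (hyp ())
closed⇒theorem (thm t)   = t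
closed⇒theorem (app d e) = mp (closed⇒theorem d) (closed⇒theorem e)

weaken : ∀ {Γ Δ A} → (∀ {B} → B ∈ Γ → B ∈ Δ) → Γ ⊩ A → Δ ⊩ A
weaken Γ⊆Δ (hyp p)   = hyp (Γ⊆Δ p)
weaken Γ⊆Δ (thm t)   = thm t
weaken Γ⊆Δ (app d e) = app (weaken Γ⊆Δ d) (weaken Γ⊆Δ e)

-- The identity law A ⊃ A, from the first two axiom schemes (S K K = I).
identity : ∀ {A} → ⊢ A ⊃ A
identity {A} = mp (mp (ax2 {A} {A ⊃ A} {A}) ax1) (ax1 {A} {A})

deduction : ∀ {Γ A B} → A ∷ Γ ⊩ B → Γ ⊩ A ⊃ B
deduction (hyp (here refl)) = thm identity
deduction (hyp (there p))   = app (thm ax1) (hyp p)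
deduction (thm t)           = app (thm ax1) (thm t)
deduction (app d e)         = app (app (thm ax2) (deduction d)) (deduction e)

-- The first hypothesis
-- Z is moved behind the remaining ones (a permutation of the context) so
-- that it is discharged last, i.e. becomes the outermost antecedent.
discharge : ∀ {B} θ Γ → θ ++ Γ ⊩ B → Γ ⊩ foldr _⊃_ B θ
discharge []      Γ d = d
discharge (Z ∷ θ) Γ d =
  deduction (discharge θ (Z ∷ Γ) (weaken moveZ d))
  where
  moveZ : ∀ {A} → A ∈ Z ∷ θ ++ Γ → A ∈ θ ++ Z ∷ Γ
  moveZ = ∈-resp-↭ (↭-sym (shift Z θ Γ))

theorem7 : (Q : Formula) (θ : List Formula)
    → All (λ Z → ∃ λ W → (Z ≡ Q[ Q ] W) ⊎ (Z ≡ QQ[ Q ] W)) θ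
    → (∃ λ W → (Q[ Q ] W ∈ θ) × (QQ[ Q ] W ∈ θ))
    → ⊢ 𝒟 Q θ
theorem7 Q θ _ (W , QW∈θ , QQW∈θ) =
  closed⇒theorem (discharge θ [] Q-from-θ)
  where
  Q-from-θ : θ ++ [] ⊩ Q
  Q-from-θ = app (hyp (∈-++⁺ˡ QQW∈θ)) (hyp (∈-++⁺ˡ QW∈θ))
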